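{- Let $k\ge 2$ be an integer, $G=(V,E)$ an undirected graph with bidirected graph $\vec G=(V,E^+\cup E^-)$. The polytope $$\mathcal Q_k=\Big\{y\in\mathbb{R}^{E^+\cup E^- }:\ y(\delta^+_{\vec G}(U))\le\tfrac{k-1}{k}|\delta_E(U)|\ \forall U\subseteq V,\ y(e^+)+y(e^-)=1\ \forall e\in E,\ y\ge0\Big\}$$ is the projection onto the $y$-variables of the polytope $$\{(y,z)\in\mathbb{R}^{E^+\cup E^- }\times\mathbb{R}^{E^+\cup E^- }:\ z(\delta^+_{\vec G}(v))=z(\delta^-_{\vec G}(v))\ \forall v\in V,\ y(e^+)+y(e^-)=1\ \forall e\in E,\ y\le z\le (k-1)y,\ y\ge 0\}.$$
   Context: The bidirected graph $\vec G$ has two oppositely oriented arcs $e^+,e^-$ for each edge $e\in E$. For $U\subseteq V$, $\delta_E(U)$ is the set of edges with exactly one end in $U$, and $\delta^\pm_{\vec G}(U)$ the arcs of $\vec G$ leaving/entering $U$; $y(A)=\sum_{a\in A}y(a)$. Inequalities between vectors are coordinatewise. -}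

module Defs where

open import Level using (Level; _⊔_) renaming (suc to lsuc)
open import Data.Nat using (ℕ; zero; suc; _∸_)
open import Data.Bool using (Bool; true; false; if_then_else_; _∧_; not; _xor_)
open import Data.Fin using (Fin)
import Data.Fin as Fin
open import Data.Fin.Subset using (Subset; ⁅_⁆)
open import Data.Vec using (lookup)
open import Data.Product using (_×_; _,_; proj₁; proj₂; ∃)
open import Algebra.Bundles using (CommutativeRing)
open import Relation.Binary.Core using (Rel)
open import Relation.Binary.Structures using (IsTotalOrder)
open import Relation.Nullary using (¬_)

record OrderedField (c ℓ₁ ℓ₂ : Level) : Set (lsuc (c ⊔ ℓ₁ ⊔ ℓ₂)) where
  field
    commutativeRing : CommutativeRing c ℓ₁
  open CommutativeRing commutativeRing public
  field
    _≤_          : Rel Carrier ℓ₂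
    isTotalOrder : IsTotalOrder _≈_ _≤_
    +-mono-≤     : ∀ {x y} z → x ≤ y → (x + z) ≤ (y + z)
    *-nonneg     : ∀ {x y} → 0# ≤ x → 0# ≤ y → 0# ≤ (x * y)
    0≉1          : ¬ (0# ≈ 1#)
    inverse      : ∀ x → ¬ (x ≈ 0#) → ∃ λ x' → (x * x') ≈ 1#

-- Orientation of an arc of the bidirected graph: e⁺ goes from the first
-- endpoint of e to the second, e⁻ from the second to the first.
data Dir : Set where
  plus minus : Dir

Arc : ℕ → Set
Arc m = Fin m × Dir

module Bidirected {n m : ℕ} (ends : Fin m → Fin n × Fin n) where

  tail : Arc m → Fin n
  tail (e , plus)  = proj₁ (ends e)
  tail (e , minus) = proj₂ (ends e)

  head : Arc m → Fin n
  head (e , plus)  = proj₂ (ends e)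
  head (e , minus) = proj₁ (ends e)

  _∈ₛ_ : Fin n → Subset n → Bool
  v ∈ₛ U = lookup U v

  leaves : Subset n → Arc m → Bool
  leaves U a = (tail a ∈ₛ U) ∧ not (head a ∈ₛ U)

  enters : Subset n → Arc m → Bool
  enters U a = not (tail a ∈ₛ U) ∧ (head a ∈ₛ U)

  crosses : Subset n → Fin m → Bool
  crosses U e = (proj₁ (ends e) ∈ₛ U) xor (proj₂ (ends e) ∈ₛ U)

module OnField {c ℓ₁ ℓ₂} (F : OrderedField c ℓ₁ ℓ₂) where
  open OrderedField F

  Σ : ∀ {m} → (Fin m → Carrier) → Carrier
  Σ {zero}  f = 0#
  Σ {suc m} f = f Fin.zero + Σ (λ i → f (Fin.suc i))

  fromℕ : ℕ → Carrier
  fromℕ zero    = 0#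
  fromℕ (suc k) = 1# + fromℕ k

  [_] : Bool → Carrier
  [ b ] = if b then 1# else 0#

  module Graph {n m : ℕ} (ends : Fin m → Fin n × Fin n) where
    open Bidirected ends public

    arcSum : (Arc m → Bool) → (Arc m → Carrier) → Carrier
    arcSum A y = Σ λ e → ([ A (e , plus) ] * y (e , plus)) + ([ A (e , minus) ] * y (e , minus))

    cut : Subset n → Carrier
    cut U = Σ λ e → [ crosses U e ]

    -- y ∈ Q_k.  The cut constraint y(δ⁺(U)) ≤ ((k-1)/k)|δ_E(U)| is written
    -- multiplied through by k > 0:  k · y(δ⁺(U)) ≤ (k-1) · |δ_E(U)|.
    record InQ (k : ℕ) (y : Arc m → Carrier) : Set (c ⊔ ℓ₁ ⊔ ℓ₂) where
      field
        cutBound : ∀ (U : Subset n) → (fromℕ k * arcSum (leaves U) y) ≤ (fromℕ (k ∸ 1) * cut U)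
        pairSum  : ∀ (e : Fin m) → (y (e , plus) + y (e , minus)) ≈ 1#
        nonneg   : ∀ (a : Arc m) → 0# ≤ y a

    record InLift (k : ℕ) (y z : Arc m → Carrier) : Set (c ⊔ ℓ₁ ⊔ ℓ₂) where
      field
        flow     : ∀ (v : Fin n) → arcSum (leaves ⁅ v ⁆) z ≈ arcSum (enters ⁅ v ⁆) z
        pairSum  : ∀ (e : Fin m) → (y (e , plus) + y (e , minus)) ≈ 1#
        lower    : ∀ (a : Arc m) → y a ≤ z a
        upper    : ∀ (a : Arc m) → z a ≤ (fromℕ (k ∸ 1) * y a)
        nonneg   : ∀ (a : Arc m) → 0# ≤ y a

-- y ∈ Q_k exactly when the circulation problem on the bidirected graph with bounds y ≤ z ≤ (k-1)y is
-- feasible.  By Hoffman's circulation theorem that happens iff y(δ⁺(U)) ≤ (k-1)·y(δ⁻(U)) for every U,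
-- and since y(e⁺) + y(e⁻) = 1 gives y(δ⁺(U)) + y(δ⁻(U)) = |δ_E(U)|, this is k·y(δ⁺(U)) ≤ (k-1)|δ_E(U)|.
-- Hoffman's theorem is proved over any ordered field in Gale's form, with a
-- modular demand function, by induction on the number of arcs: every vertex set U confines the value of
-- the first arc to an interval, these intervals meet pairwise because the capacity function is
-- submodular, so a common value exists; fixing it moves that arc's contribution into the demand.
module Submission where

open import Defs
open import Algebra.Bundles using (CommutativeRing)
open import Relation.Binary.Bundles using (Poset)
open import Relation.Binary.Structures using (IsTotalOrder)
import Relation.Binary.Reasoning.PartialOrder
import Relation.Binary.Reasoning.Setoid
open import Data.Nat as ℕ using (ℕ; zero; suc)
open import Data.Integer as ℤ using (ℤ; +_; -[1+_]; _⊖_)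
import Data.Integer.Properties as ℤ
import Data.Nat.Properties as ℕ
open import Data.Sign as Sign using (Sign)
open import Data.Maybe using (Maybe; just; nothing)
open import Data.Sum using (inj₁; inj₂)
open import Data.Bool as Bool using (Bool; true; false; not; _∧_; _∨_)
open import Data.Fin using (Fin; zero; suc)
open import Data.Fin.Subset using (Subset; _∪_; _∩_; ∁; ⊥; ⁅_⁆)
open import Data.Vec using ([]; _∷_; lookup)
open import Data.Vec.Properties using (lookup-zipWith; lookup-map; lookup-replicate)
open import Data.Vec.Functional as Vector using (Vector)
open import Data.Product using (_×_; _,_; ∃; proj₁; proj₂; map₁)
open import Function using (_∘_)
open import Function.Bundles using (_⇔_; mk⇔; Equivalence)
open import Relation.Nullary using (yes; no)
open import Relation.Binary.PropositionalEquality as ≡ using (_≡_; _≢_)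

-- Algebra.Solver.Ring needs coefficients with decidable equality; ℤ maps into every commutative ring.
module IntegerCoefficientRingSolver {c ℓ} (R : CommutativeRing c ℓ) where
  open CommutativeRing R
  open import Algebra.Properties.Ring ring using (-‿distribˡ-*; -‿distribʳ-*)
  open import Algebra.Properties.AbelianGroup +-abelianGroup using (⁻¹-∙-comm; ε⁻¹≈ε; ⁻¹-involutive)
  open import Algebra.Properties.CommutativeSemigroup +-commutativeSemigroup using (interchange)
  open import Algebra.Properties.Semiring.Mult.TCOptimised semiring
    renaming (_×_ to _×′_) using (1+×; ×-homo-+; ×1-homo-*)
  import Algebra.Solver.Ring.AlmostCommutativeRing as ACR
  open import Relation.Binary.Reasoning.Setoid setoid

  private
    -- The optimised ×′ has 1 ×′ x = x, so that con (+ 1) denotes 1# on the nose.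
    ⟦_⟧ : ℤ → Carrier
    ⟦ + n ⟧      = n ×′ 1#
    ⟦ -[1+ n ] ⟧ = - (suc n ×′ 1#)

    1+x-[1+y]≈x-y : ∀ x y → (1# + x) - (1# + y) ≈ x - y
    1+x-[1+y]≈x-y x y = begin
      (1# + x) + - (1# + y)    ≈⟨ +-congˡ (⁻¹-∙-comm 1# y) ⟨
      (1# + x) + (- 1# + - y)  ≈⟨ interchange 1# x (- 1#) (- y) ⟩
      (1# - 1#) + (x - y)      ≈⟨ +-congʳ (-‿inverseʳ 1#) ⟩
      0# + (x - y)             ≈⟨ +-identityˡ (x - y) ⟩
      x - y                    ∎

    ⊖-homo : ∀ m n → ⟦ m ⊖ n ⟧ ≈ m ×′ 1# - n ×′ 1#
    ⊖-homo m       zero    = sym (trans (+-congˡ ε⁻¹≈ε) (+-identityʳ _))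
    ⊖-homo zero    (suc n) = sym (+-identityˡ _)
    ⊖-homo (suc m) (suc n) = begin
      ⟦ suc m ⊖ suc n ⟧                  ≡⟨ ≡.cong ⟦_⟧ (ℤ.[1+m]⊖[1+n]≡m⊖n m n) ⟩
      ⟦ m ⊖ n ⟧                          ≈⟨ ⊖-homo m n ⟩
      m ×′ 1# - n ×′ 1#                  ≈⟨ 1+x-[1+y]≈x-y _ _ ⟨
      (1# + m ×′ 1#) - (1# + n ×′ 1#)    ≈⟨ +-cong (1+× m 1#) (-‿cong (1+× n 1#)) ⟨
      suc m ×′ 1# - suc n ×′ 1#          ∎

    +-homo : ∀ i j → ⟦ i ℤ.+ j ⟧ ≈ ⟦ i ⟧ + ⟦ j ⟧
    +-homo (+ m)      (+ n)      = ×-homo-+ 1# m n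
    +-homo (+ m)      -[1+ n ]   = ⊖-homo m (suc n)
    +-homo -[1+ m ]   (+ n)      = trans (⊖-homo n (suc m)) (+-comm _ _)
    +-homo -[1+ m ]   -[1+ n ]   = begin
      - (suc (suc (m ℕ.+ n)) ×′ 1#)        ≡⟨ ≡.cong (λ k → - (suc k ×′ 1#)) (ℕ.+-suc m n) ⟨
      - ((suc m ℕ.+ suc n) ×′ 1#)          ≈⟨ -‿cong (×-homo-+ 1# (suc m) (suc n)) ⟩
      - (suc m ×′ 1# + suc n ×′ 1#)        ≈⟨ ⁻¹-∙-comm _ _ ⟨
      - (suc m ×′ 1#) + - (suc n ×′ 1#)    ∎

    +◃-homo : ∀ n → ⟦ Sign.+ ℤ.◃ n ⟧ ≈ n ×′ 1#
    +◃-homo zero    = refl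
    +◃-homo (suc n) = refl

    -◃-homo : ∀ n → ⟦ Sign.- ℤ.◃ n ⟧ ≈ - (n ×′ 1#)
    -◃-homo zero    = sym ε⁻¹≈ε
    -◃-homo (suc n) = refl

    *-homo : ∀ i j → ⟦ i ℤ.* j ⟧ ≈ ⟦ i ⟧ * ⟦ j ⟧
    *-homo (+ m) (+ n) = trans (+◃-homo (m ℕ.* n)) (×1-homo-* m n)
    *-homo (+ m) -[1+ n ] = begin
      ⟦ Sign.- ℤ.◃ (m ℕ.* suc n) ⟧   ≈⟨ -◃-homo (m ℕ.* suc n) ⟩
      - ((m ℕ.* suc n) ×′ 1#)        ≈⟨ -‿cong (×1-homo-* m (suc n)) ⟩
      - (m ×′ 1# * suc n ×′ 1#)      ≈⟨ -‿distribʳ-* _ _ ⟩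
      m ×′ 1# * - (suc n ×′ 1#)      ∎
    *-homo -[1+ m ] (+ n) = begin
      ⟦ Sign.- ℤ.◃ (suc m ℕ.* n) ⟧   ≈⟨ -◃-homo (suc m ℕ.* n) ⟩
      - ((suc m ℕ.* n) ×′ 1#)        ≈⟨ -‿cong (×1-homo-* (suc m) n) ⟩
      - (suc m ×′ 1# * n ×′ 1#)      ≈⟨ -‿distribˡ-* _ _ ⟩
      - (suc m ×′ 1#) * n ×′ 1#      ∎
    *-homo -[1+ m ] -[1+ n ] = begin
      (suc m ℕ.* suc n) ×′ 1#             ≈⟨ ×1-homo-* (suc m) (suc n) ⟩
      suc m ×′ 1# * suc n ×′ 1#           ≈⟨ ⁻¹-involutive _ ⟨
      - - (suc m ×′ 1# * suc n ×′ 1#)     ≈⟨ -‿cong (-‿distribˡ-* _ _) ⟩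
      - (- (suc m ×′ 1#) * suc n ×′ 1#)   ≈⟨ -‿distribʳ-* _ _ ⟩
      - (suc m ×′ 1#) * - (suc n ×′ 1#)   ∎

    -‿homo : ∀ i → ⟦ ℤ.- i ⟧ ≈ - ⟦ i ⟧
    -‿homo -[1+ n ]    = sym (⁻¹-involutive _)
    -‿homo (+ zero)    = sym ε⁻¹≈ε
    -‿homo (+ suc n)   = refl

    homomorphism : ℤ.+-*-rawRing ACR.-Raw-AlmostCommutative⟶ ACR.fromCommutativeRing R
    homomorphism = record
      { ⟦_⟧ = ⟦_⟧ ; +-homo = +-homo ; *-homo = *-homo ; -‿homo = -‿homo
      ; 0-homo = refl ; 1-homo = refl }

    ⟦⟧-equal? : ∀ i j → Maybe (⟦ i ⟧ ≈ ⟦ j ⟧)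
    ⟦⟧-equal? i j with i ℤ.≟ j
    ... | yes ≡.refl = just refl
    ... | no _       = nothing

  open import Algebra.Solver.Ring ℤ.+-*-rawRing (ACR.fromCommutativeRing R) homomorphism ⟦⟧-equal? public

module CommutativeRingProperties {c ℓ} (R : CommutativeRing c ℓ) where
  open CommutativeRing R
  open IntegerCoefficientRingSolver R using (solve; _:=_; _:+_; _:-_)
  open import Algebra.Properties.Semiring.Sum semiring using (sum)
  open import Algebra.Properties.Group +-group using (x∙y⁻¹≈ε⇒x≈y; x≈y⇒x∙y⁻¹≈ε)

  x-y≈0⇔y≈x : ∀ {x y} → x - y ≈ 0# ⇔ y ≈ x
  x-y≈0⇔y≈x = mk⇔ (sym ∘ x∙y⁻¹≈ε⇒x≈y _ _) (x≈y⇒x∙y⁻¹≈ε ∘ sym)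

  difference-interchange : ∀ a b p q → (a - p) + (b - q) ≈ (a + b) - (p + q)
  difference-interchange = solve 4 (λ a b p q → (a :- p) :+ (b :- q) := (a :+ b) :- (p :+ q)) refl

  ∑-distrib-difference : ∀ {m} (f g : Vector Carrier m) → sum (λ i → f i - g i) ≈ sum f - sum g
  ∑-distrib-difference {zero}  f g = sym (-‿inverseʳ 0#)
  ∑-distrib-difference {suc m} f g = trans (+-congˡ (∑-distrib-difference (f ∘ suc) (g ∘ suc))) (difference-interchange _ _ _ _)

module OrderedFieldProperties {c ℓ₁ ℓ₂} (F : OrderedField c ℓ₁ ℓ₂) where
  open OrderedField F hiding (zero) renaming (+-mono-≤ to +-monoˡ-≤; _≤_ to infix 4 _≤_)
  open OnField F using (fromℕ; [_])
  open IntegerCoefficientRingSolver commutativeRing using (solve; _:=_; _:+_; _:-_; _:*_; :-_; con)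
  open IsTotalOrder isTotalOrder public using (total; antisym; isPartialOrder)
    renaming (refl to ≤-refl; reflexive to ≤-reflexive; trans to ≤-trans; ≲-respʳ-≈ to ≤-respʳ-≈)

  ≤-poset : Poset c ℓ₁ ℓ₂
  ≤-poset = record { isPartialOrder = isPartialOrder }

  module ≤-Reasoning = Relation.Binary.Reasoning.PartialOrder ≤-poset
  module ≈-Reasoning = Relation.Binary.Reasoning.Setoid setoid

  open import Algebra.Properties.Semiring.Sum semiring using (sum)

  +-monoʳ-≤ : ∀ x {y z} → y ≤ z → x + y ≤ x + z
  +-monoʳ-≤ x {y} {z} y≤z = begin
    x + y  ≈⟨ +-comm x y ⟩
    y + x  ≤⟨ +-monoˡ-≤ x y≤z ⟩
    z + x  ≈⟨ +-comm z x ⟩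
    x + z  ∎
    where open ≤-Reasoning

  +-mono-≤ : ∀ {x y u v} → x ≤ y → u ≤ v → x + u ≤ y + v
  +-mono-≤ {y = y} {u = u} x≤y u≤v = ≤-trans (+-monoˡ-≤ u x≤y) (+-monoʳ-≤ y u≤v)

  x≤y⇒0≤y-x : ∀ {x y} → x ≤ y → 0# ≤ y - x
  x≤y⇒0≤y-x {x} {y} x≤y = begin
    0#     ≈⟨ -‿inverseʳ x ⟨
    x - x  ≤⟨ +-monoˡ-≤ (- x) x≤y ⟩
    y - x  ∎
    where open ≤-Reasoning

  0≤y-x⇒x≤y : ∀ {x y} → 0# ≤ y - x → x ≤ y
  0≤y-x⇒x≤y {x} {y} 0≤y-x = begin
    x            ≈⟨ +-identityˡ x ⟨
    0# + x       ≤⟨ +-monoˡ-≤ x 0≤y-x ⟩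
    (y - x) + x  ≈⟨ solve 2 (λ x y → (y :- x) :+ x := y) refl x y ⟩
    y            ∎
    where open ≤-Reasoning

  ≤-resp-difference : ∀ {x y x′ y′} → y - x ≈ y′ - x′ → x ≤ y → x′ ≤ y′
  ≤-resp-difference gap x≤y = 0≤y-x⇒x≤y (≤-respʳ-≈ gap (x≤y⇒0≤y-x x≤y))

  0≤1 : 0# ≤ 1#
  0≤1 with total 0# 1#
  ... | inj₁ 0≤1 = 0≤1
  ... | inj₂ 1≤0 = ≤-resp-difference (solve 0 (:- con (+ 1) :* :- con (+ 1) :- con (+ 0) := con (+ 1) :- con (+ 0)) refl)
                                     (*-nonneg 0≤-1 0≤-1)
    where
    0≤-1 : 0# ≤ - 1#
    0≤-1 = ≤-resp-difference (solve 0 (con (+ 0) :- con (+ 1) := :- con (+ 1) :- con (+ 0)) refl) 1≤0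

  0≤fromℕ : ∀ n → 0# ≤ fromℕ n
  0≤fromℕ zero    = ≤-refl
  0≤fromℕ (suc n) = ≤-trans (≤-reflexive (sym (+-identityʳ 0#))) (+-mono-≤ 0≤1 (0≤fromℕ n))

  0≤[b] : ∀ b → 0# ≤ [ b ]
  0≤[b] false = ≤-refl
  0≤[b] true  = 0≤1

  *-monoʳ-≤-nonNeg : ∀ {z} → 0# ≤ z → ∀ {x y} → x ≤ y → z * x ≤ z * y
  *-monoʳ-≤-nonNeg {z} 0≤z {x} {y} x≤y =
    ≤-resp-difference (solve 3 (λ z x y → z :* (y :- x) :- con (+ 0) := z :* y :- z :* x) refl z x y)
                      (*-nonneg 0≤z (x≤y⇒0≤y-x x≤y))

  x≤-y⇒y≤-x : ∀ {x y} → x ≤ - y → y ≤ - x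
  x≤-y⇒y≤-x {x} {y} = ≤-resp-difference (solve 2 (λ x y → :- y :- x := :- x :- y) refl x y)

  x≤[1+k]x : ∀ {k x} → 0# ≤ k → 0# ≤ x → x ≤ (1# + k) * x
  x≤[1+k]x {k} {x} 0≤k 0≤x =
    ≤-resp-difference (solve 2 (λ k x → k :* x :- con (+ 0) := (con (+ 1) :+ k) :* x :- x) refl k x) (*-nonneg 0≤k 0≤x)

  [1+k]x≤k[x+y]⇔x≤ky : ∀ k x y → (1# + k) * x ≤ k * (x + y) ⇔ x ≤ k * y
  [1+k]x≤k[x+y]⇔x≤ky k x y = mk⇔ (≤-resp-difference gap) (≤-resp-difference (sym gap))
    where
    gap : k * (x + y) - (1# + k) * x ≈ k * y - x
    gap = solve 3 (λ k x y → k :* (x :+ y) :- (con (+ 1) :+ k) :* x := k :* y :- x) refl k x y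

  max : Carrier → Carrier → Carrier
  max x y with total x y
  ... | inj₁ _ = y
  ... | inj₂ _ = x

  x≤max[x,y] : ∀ x y → x ≤ max x y
  x≤max[x,y] x y with total x y
  ... | inj₁ x≤y = x≤y
  ... | inj₂ _   = ≤-refl

  y≤max[x,y] : ∀ x y → y ≤ max x y
  y≤max[x,y] x y with total x y
  ... | inj₁ _   = ≤-refl
  ... | inj₂ y≤x = y≤x

  max-lub : ∀ {x y z} → x ≤ z → y ≤ z → max x y ≤ z
  max-lub {x} {y} x≤z y≤z with total x y
  ... | inj₁ _ = y≤z
  ... | inj₂ _ = x≤z

  ⨆ : ∀ {n} → (Subset n → Carrier) → Carrier
  ⨆ {zero}  h = h []
  ⨆ {suc n} h = max (⨆ (h ∘ (true ∷_))) (⨆ (h ∘ (false ∷_)))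

  ≤-⨆ : ∀ {n} (h : Subset n → Carrier) U → h U ≤ ⨆ h
  ≤-⨆ h []          = ≤-refl
  ≤-⨆ h (true ∷ U)  = ≤-trans (≤-⨆ (h ∘ (true ∷_)) U) (x≤max[x,y] _ _)
  ≤-⨆ h (false ∷ U) = ≤-trans (≤-⨆ (h ∘ (false ∷_)) U) (y≤max[x,y] _ _)

  ⨆-lub : ∀ {n} (h : Subset n → Carrier) {x} → (∀ U → h U ≤ x) → ⨆ h ≤ x
  ⨆-lub {zero}  h h≤x = h≤x []
  ⨆-lub {suc n} h h≤x = max-lub (⨆-lub (h ∘ (true ∷_)) (h≤x ∘ (true ∷_))) (⨆-lub (h ∘ (false ∷_)) (h≤x ∘ (false ∷_)))

  separation : ∀ {n} (lo hi : Subset n → Carrier) → (∀ U W → lo U ≤ hi W) →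
               ∃ λ x → (∀ U → lo U ≤ x) × (∀ W → x ≤ hi W)
  separation lo hi lo≤hi = ⨆ lo , ≤-⨆ lo , λ W → ⨆-lub lo (λ U → lo≤hi U W)

  sum-mono-≤ : ∀ {m} {f g : Vector Carrier m} → (∀ i → f i ≤ g i) → sum f ≤ sum g
  sum-mono-≤ {zero}  f≤g = ≤-refl
  sum-mono-≤ {suc m} f≤g = +-mono-≤ (f≤g zero) (sum-mono-≤ (f≤g ∘ suc))

module FeasibleFlows {c ℓ₁ ℓ₂} (F : OrderedField c ℓ₁ ℓ₂) where
  open OrderedField F hiding (zero; +-mono-≤) renaming (_≤_ to infix 4 _≤_)
  open OrderedFieldProperties F
  open OnField F using ([_])
  open IntegerCoefficientRingSolver commutativeRing using (solve; _:=_; _:+_; _:-_; _:*_; :-_; con)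
  open CommutativeRingProperties commutativeRing
  open import Algebra.Properties.Semiring.Sum semiring
    using (sum; sum-cong-≋; sum-replicate-zero; ∑-distrib-+; ∑-comm; *-distribˡ-sum; *-distribʳ-sum)

  -- The Boolean arguments say whether the tail, resp. the head, of an arc lies in the set considered.
  across : Bool → Bool → Carrier → Carrier → Carrier
  across false true  p q = p
  across true  false p q = q
  across false false p q = 0#
  across true  true  p q = 0#

  across-∪ : ∀ {n} (U W : Subset n) s t p q →
             across (lookup (U ∪ W) s) (lookup (U ∪ W) t) p q ≡ across (lookup U s ∨ lookup W s) (lookup U t ∨ lookup W t) p q
  across-∪ U W s t p q = ≡.cong₂ (λ a b → across a b p q) (lookup-zipWith _∨_ s U W) (lookup-zipWith _∨_ t U W)

  across-∩ : ∀ {n} (U W : Subset n) s t p q →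
             across (lookup (U ∩ W) s) (lookup (U ∩ W) t) p q ≡ across (lookup U s ∧ lookup W s) (lookup U t ∧ lookup W t) p q
  across-∩ U W s t p q = ≡.cong₂ (λ a b → across a b p q) (lookup-zipWith _∧_ s U W) (lookup-zipWith _∧_ t U W)

  across-submodular : ∀ {l u} → l ≤ u → ∀ a b a′ b′ →
    across (a ∨ a′) (b ∨ b′) u (- l) + across (a ∧ a′) (b ∧ b′) u (- l) ≤ across a b u (- l) + across a′ b′ u (- l)
  across-submodular l≤u false false false false = ≤-refl
  across-submodular l≤u false false false true  = ≤-reflexive (+-comm _ _)
  across-submodular l≤u false false true  false = ≤-reflexive (+-comm _ _)
  across-submodular l≤u false false true  true  = ≤-refl
  across-submodular l≤u false true  false false = ≤-refl
  across-submodular l≤u false true  false true  = ≤-refl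
  across-submodular {l} {u} l≤u false true  true  false =
    ≤-resp-difference (solve 2 (λ l u → u :- l := u :+ :- l :- (con (+ 0) :+ con (+ 0))) refl l u) l≤u
  across-submodular l≤u false true  true  true  = ≤-reflexive (+-comm _ _)
  across-submodular l≤u true  false false false = ≤-refl
  across-submodular {l} {u} l≤u true  false false true  =
    ≤-resp-difference (solve 2 (λ l u → u :- l := :- l :+ u :- (con (+ 0) :+ con (+ 0))) refl l u) l≤u
  across-submodular l≤u true  false true  false = ≤-refl
  across-submodular l≤u true  false true  true  = ≤-reflexive (+-comm _ _)
  across-submodular l≤u true  true  false false = ≤-refl
  across-submodular l≤u true  true  false true  = ≤-refl
  across-submodular l≤u true  true  true  false = ≤-refl
  across-submodular l≤u true  true  true  true  = ≤-refl

  across-net : ∀ a b x → across a b x (- x) ≈ ([ b ] - [ a ]) * x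
  across-net false false x = solve 1 (λ x → con (+ 0) := (con (+ 0) :- con (+ 0)) :* x) refl x
  across-net false true  x = solve 1 (λ x → x := (con (+ 1) :- con (+ 0)) :* x) refl x
  across-net true  false x = solve 1 (λ x → :- x := (con (+ 0) :- con (+ 1)) :* x) refl x
  across-net true  true  x = solve 1 (λ x → con (+ 0) := (con (+ 1) :- con (+ 1)) :* x) refl x

  across-entering-leaving : ∀ a b p q → across a b p (- q) ≈ [ not a ∧ b ] * p - [ a ∧ not b ] * q
  across-entering-leaving false false p q = solve 2 (λ p q → con (+ 0) := con (+ 0) :* p :- con (+ 0) :* q) refl p q
  across-entering-leaving false true  p q = solve 2 (λ p q → p := con (+ 1) :* p :- con (+ 0) :* q) refl p q
  across-entering-leaving true  false p q = solve 2 (λ p q → :- q := con (+ 0) :* p :- con (+ 1) :* q) refl p q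
  across-entering-leaving true  true  p q = solve 2 (λ p q → con (+ 0) := con (+ 0) :* p :- con (+ 0) :* q) refl p q

  [a]+[b]≈[a∨b]+[a∧b] : ∀ a b → [ a ] + [ b ] ≈ [ a ∨ b ] + [ a ∧ b ]
  [a]+[b]≈[a∨b]+[a∧b] false false = refl
  [a]+[b]≈[a∨b]+[a∧b] false true  = +-comm _ _
  [a]+[b]≈[a∨b]+[a∧b] true  false = refl
  [a]+[b]≈[a∨b]+[a∧b] true  true  = refl

  [a]+[¬a]≈1 : ∀ a → [ a ] + [ not a ] ≈ 1#
  [a]+[¬a]≈1 false = +-identityˡ 1#
  [a]+[¬a]≈1 true  = +-identityʳ 1#

  Submodular : ∀ {n} → (Subset n → Carrier) → Set ℓ₂
  Submodular h = ∀ U W → h (U ∪ W) + h (U ∩ W) ≤ h U + h W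

  Modular : ∀ {n} → (Subset n → Carrier) → Set ℓ₁
  Modular β = ∀ U W → β U + β W ≈ β (U ∪ W) + β (U ∩ W)

  -- Exactly the set functions U ↦ b(U) of vertex demands b with b(V) = 0.
  record IsNetDemand {n} (β : Subset n → Carrier) : Set ℓ₁ where
    field
      modular       : Modular β
      complementary : ∀ U → β U + β (∁ U) ≈ 0#

  0-isNetDemand : ∀ {n} → IsNetDemand {n} (λ _ → 0#)
  0-isNetDemand = record { modular = λ _ _ → refl ; complementary = λ _ → +-identityʳ 0# }

  isNetDemand-resp-≈ : ∀ {n} {β γ : Subset n → Carrier} → (∀ U → β U ≈ γ U) → IsNetDemand β → IsNetDemand γ
  isNetDemand-resp-≈ {β = β} {γ} β≈γ β-demand = record
    { modular       = λ U W → trans (+-cong (sym (β≈γ U)) (sym (β≈γ W)))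
                                    (trans (modular U W) (+-cong (β≈γ (U ∪ W)) (β≈γ (U ∩ W))))
    ; complementary = λ U → trans (+-cong (sym (β≈γ U)) (sym (β≈γ (∁ U)))) (complementary U)
    }
    where open IsNetDemand β-demand

  modular-difference-isNetDemand : ∀ {n} {β γ : Subset n → Carrier} → Modular β → Modular γ →
    (∀ U → β U + β (∁ U) ≈ γ U + γ (∁ U)) → IsNetDemand (λ U → β U - γ U)
  modular-difference-isNetDemand {β = β} {γ} β-modular γ-modular same-total = record
    { modular       = λ U W → begin
        (β U - γ U) + (β W - γ W)                            ≈⟨ difference-interchange (β U) (β W) (γ U) (γ W) ⟩
        (β U + β W) - (γ U + γ W)                            ≈⟨ +-cong (β-modular U W) (-‿cong (γ-modular U W)) ⟩
        (β (U ∪ W) + β (U ∩ W)) - (γ (U ∪ W) + γ (U ∩ W))    ≈⟨ difference-interchange _ _ _ _ ⟨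
        (β (U ∪ W) - γ (U ∪ W)) + (β (U ∩ W) - γ (U ∩ W))    ∎
    ; complementary = λ U → begin
        (β U - γ U) + (β (∁ U) - γ (∁ U))                    ≈⟨ difference-interchange _ _ _ _ ⟩
        (β U + β (∁ U)) - (γ U + γ (∁ U))                    ≈⟨ +-congʳ (same-total U) ⟩
        (γ U + γ (∁ U)) - (γ U + γ (∁ U))                    ≈⟨ -‿inverseʳ _ ⟩
        0#                                                   ∎
    }
    where open ≈-Reasoning

  difference-isNetDemand : ∀ {n} {β γ : Subset n → Carrier} → IsNetDemand β → IsNetDemand γ → IsNetDemand (λ U → β U - γ U)
  difference-isNetDemand β-demand γ-demand =
    modular-difference-isNetDemand B.modular Γ.modular (λ U → trans (B.complementary U) (sym (Γ.complementary U)))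
    where
    module B = IsNetDemand β-demand
    module Γ = IsNetDemand γ-demand

  scale-isNetDemand : ∀ {n} {β : Subset n → Carrier} x → IsNetDemand β → IsNetDemand (λ U → β U * x)
  scale-isNetDemand {β = β} x β-demand = record
    { modular       = λ U W → trans (sym (distribʳ x _ _)) (trans (*-congʳ (modular U W)) (distribʳ x _ _))
    ; complementary = λ U → trans (sym (distribʳ x _ _)) (trans (*-congʳ (complementary U)) (zeroˡ x))
    }
    where open IsNetDemand β-demand

  membership-modular : ∀ {n} (v : Fin n) → Modular (λ U → [ lookup U v ])
  membership-modular v U W = trans ([a]+[b]≈[a∨b]+[a∧b] (lookup U v) (lookup W v))
    (reflexive (≡.sym (≡.cong₂ (λ a b → [ a ] + [ b ]) (lookup-zipWith _∨_ v U W) (lookup-zipWith _∧_ v U W))))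

  membership-complementary : ∀ {n} (v : Fin n) U → [ lookup U v ] + [ lookup (∁ U) v ] ≈ 1#
  membership-complementary v U = trans (reflexive (≡.cong (λ a → [ lookup U v ] + [ a ]) (lookup-map v not U))) ([a]+[¬a]≈1 (lookup U v))

  arc-isNetDemand : ∀ {n} (s t : Fin n) x → IsNetDemand (λ U → across (lookup U s) (lookup U t) x (- x))
  arc-isNetDemand s t x = isNetDemand-resp-≈ (λ U → sym (across-net (lookup U s) (lookup U t) x))
    (scale-isNetDemand x (modular-difference-isNetDemand (membership-modular t) (membership-modular s)
      (λ U → trans (membership-complementary t U) (sym (membership-complementary s U)))))

  nonpositive-netDemand≈0 : ∀ {n} {β : Subset n → Carrier} → IsNetDemand β → (∀ U → β U ≤ 0#) → ∀ U → β U ≈ 0#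
  nonpositive-netDemand≈0 {β = β} β-demand β≤0 U = antisym (β≤0 U) (≤-resp-difference gap (β≤0 (∁ U)))
    where
    gap : 0# - β (∁ U) ≈ β U - 0#
    gap = begin
      0# - β (∁ U)                ≈⟨ +-congʳ (IsNetDemand.complementary β-demand U) ⟨
      (β U + β (∁ U)) - β (∁ U)   ≈⟨ solve 2 (λ a b → (a :+ b) :- b := a :- con (+ 0)) refl (β U) (β (∁ U)) ⟩
      β U - 0#                    ∎
      where open ≈-Reasoning

  module _ {l u : Carrier} (l≤u : l ≤ u) where

    -- If the other arcs fall short of the demand at U by d, then a value x on this arc (with bounds
    -- l ≤ u) is admissible for U exactly when  lowerEnd ≤ x ≤ upperEnd.
    lowerEnd : Bool → Bool → Carrier → Carrier
    lowerEnd false true  d = d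
    lowerEnd false false d = l
    lowerEnd true  _     d = l

    upperEnd : Bool → Bool → Carrier → Carrier
    upperEnd true  false d = - d
    upperEnd true  true  d = u
    upperEnd false _     d = u

    lowerEnd≤u : ∀ a b {d} → d ≤ across a b u (- l) → lowerEnd a b d ≤ u
    lowerEnd≤u false true  d≤ = d≤
    lowerEnd≤u false false _  = l≤u
    lowerEnd≤u true  _     _  = l≤u

    l≤upperEnd : ∀ a b {d} → d ≤ across a b u (- l) → l ≤ upperEnd a b d
    l≤upperEnd true  false d≤ = x≤-y⇒y≤-x d≤
    l≤upperEnd true  true  _  = l≤u
    l≤upperEnd false _     _  = l≤u

    ends-meet : ∀ a b a′ b′ {d d′} → d ≤ across a b u (- l) → d′ ≤ across a′ b′ u (- l) →
                d + d′ ≤ across (a ∨ a′) (b ∨ b′) u (- l) + across (a ∧ a′) (b ∧ b′) u (- l) →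
                lowerEnd a b d ≤ upperEnd a′ b′ d′
    ends-meet a     b     false _     d≤ _   _    = lowerEnd≤u a b d≤
    ends-meet a     b     true  true  d≤ _   _    = lowerEnd≤u a b d≤
    ends-meet false true  true  false {d} {d′} _ _ d+d′≤0 =
      ≤-resp-difference (solve 2 (λ d d′ → (con (+ 0) :+ con (+ 0)) :- (d :+ d′) := :- d′ :- d) refl d d′) d+d′≤0
    ends-meet false false true  false _  d′≤ _    = l≤upperEnd true false d′≤
    ends-meet true  _     true  false _  d′≤ _    = l≤upperEnd true false d′≤

    between-ends : ∀ a b {d x} → lowerEnd a b d ≤ x → x ≤ upperEnd a b d → d ≤ across a b u (- l) → d ≤ across a b x (- x)
    between-ends false true  d≤x _   _  = d≤x
    between-ends true  false _   x≤d _  = x≤-y⇒y≤-x x≤d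
    between-ends false false _   _   d≤ = d≤
    between-ends true  true  _   _   d≤ = d≤

  fix-arc-value : ∀ {n} (s t : Fin n) {l u} → l ≤ u → (β c : Subset n → Carrier) → Modular β → Submodular c →
    (∀ U → β U ≤ across (lookup U s) (lookup U t) u (- l) + c U) →
    ∃ λ x → (l ≤ x × x ≤ u) × (∀ U → β U - across (lookup U s) (lookup U t) x (- x) ≤ c U)
  fix-arc-value {n} s t {l} {u} l≤u β c β-modular c-submodular β≤ = x , (l≤x , x≤u) , fits
    where
    arc : Subset n → Carrier → Carrier → Carrier
    arc U = across (lookup U s) (lookup U t)

    d : Subset n → Carrier
    d U = β U - c U

    d≤ : ∀ U → d U ≤ arc U u (- l)
    d≤ U = ≤-resp-difference (solve 3 (λ a b c → (a :+ c) :- b := a :- (b :- c)) refl (arc U u (- l)) (β U) (c U)) (β≤ U)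

    d-supermodular : ∀ U W → d U + d W ≤ d (U ∪ W) + d (U ∩ W)
    d-supermodular U W = ≤-resp-difference gap (c-submodular U W)
      where
      gap : (c U + c W) - (c (U ∪ W) + c (U ∩ W)) ≈ (d (U ∪ W) + d (U ∩ W)) - (d U + d W)
      gap = begin
        c-gap                                  ≈⟨ +-identityˡ c-gap ⟨
        0# + c-gap                             ≈⟨ +-congʳ β-balanced ⟨
        (β∪∩ - (β U + β W)) + c-gap            ≈⟨ regroup (β (U ∪ W)) (β (U ∩ W)) (β U) (β W) _ _ _ _ ⟩
        (d (U ∪ W) + d (U ∩ W)) - (d U + d W)  ∎
        where
        c-gap = (c U + c W) - (c (U ∪ W) + c (U ∩ W))
        β∪∩   = β (U ∪ W) + β (U ∩ W)
        β-balanced : β∪∩ - (β U + β W) ≈ 0#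
        β-balanced = trans (+-congˡ (-‿cong (β-modular U W))) (-‿inverseʳ β∪∩)
        regroup : ∀ b₁ b₂ b₃ b₄ c₁ c₂ c₃ c₄ →
          ((b₁ + b₂) - (b₃ + b₄)) + ((c₃ + c₄) - (c₁ + c₂)) ≈ ((b₁ - c₁) + (b₂ - c₂)) - ((b₃ - c₃) + (b₄ - c₄))
        regroup = solve 8 (λ b₁ b₂ b₃ b₄ c₁ c₂ c₃ c₄ →
          ((b₁ :+ b₂) :- (b₃ :+ b₄)) :+ ((c₃ :+ c₄) :- (c₁ :+ c₂))
            := ((b₁ :- c₁) :+ (b₂ :- c₂)) :- ((b₃ :- c₃) :+ (b₄ :- c₄))) refl
        open ≈-Reasoning

    meet : ∀ U W → lowerEnd l≤u (lookup U s) (lookup U t) (d U) ≤ upperEnd l≤u (lookup W s) (lookup W t) (d W)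
    meet U W = ends-meet l≤u _ _ _ _ (d≤ U) (d≤ W) (≤-trans (d-supermodular U W) (+-mono-≤ d∪≤ d∩≤))
      where
      d∪≤ = ≡.subst (d (U ∪ W) ≤_) (across-∪ U W s t u (- l)) (d≤ (U ∪ W))
      d∩≤ = ≡.subst (d (U ∩ W) ≤_) (across-∩ U W s t u (- l)) (d≤ (U ∩ W))

    interval = separation _ _ meet
    x = proj₁ interval

    lookup-⊥ : ∀ v → lookup ⊥ v ≡ false
    lookup-⊥ v = lookup-replicate v false

    l≤x : l ≤ x
    l≤x = ≡.subst₂ (λ a b → lowerEnd l≤u a b (d ⊥) ≤ x) (lookup-⊥ s) (lookup-⊥ t) (proj₁ (proj₂ interval) ⊥)

    x≤u : x ≤ u
    x≤u = ≡.subst₂ (λ a b → x ≤ upperEnd l≤u a b (d ⊥)) (lookup-⊥ s) (lookup-⊥ t) (proj₂ (proj₂ interval) ⊥)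

    fits : ∀ U → β U - arc U x (- x) ≤ c U
    fits U = ≤-resp-difference (solve 3 (λ a b c → a :- (b :- c) := c :- (b :- a)) refl (arc U x (- x)) (β U) (c U))
      (between-ends l≤u (lookup U s) (lookup U t) (proj₁ (proj₂ interval) U) (proj₂ (proj₂ interval) U) (d≤ U))

  membership-expansion : ∀ {n} (X : Subset n) p → sum (λ v → [ lookup X v ] * [ lookup ⁅ v ⁆ p ]) ≈ [ lookup X p ]
  membership-expansion {suc n} (b ∷ X) zero = begin
    [ b ] * 1# + sum (λ v → [ lookup X v ] * 0#)
      ≈⟨ +-cong (*-identityʳ [ b ]) (trans (sum-cong-≋ (λ v → zeroʳ [ lookup X v ])) (sum-replicate-zero n)) ⟩
    [ b ] + 0#                                    ≈⟨ +-identityʳ [ b ] ⟩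
    [ b ]                                         ∎
    where open ≈-Reasoning
  membership-expansion {suc n} (b ∷ X) (suc p) = begin
    [ b ] * [ lookup ⊥ p ] + sum (λ v → [ lookup X v ] * [ lookup ⁅ v ⁆ p ])
      ≈⟨ +-cong (*-congˡ (reflexive (≡.cong [_] (lookup-replicate p false)))) (membership-expansion X p) ⟩
    [ b ] * 0# + [ lookup X p ]
      ≈⟨ trans (+-congʳ (zeroʳ [ b ])) (+-identityˡ _) ⟩
    [ lookup X p ]
      ∎
    where open ≈-Reasoning

  module Digraph {n M : ℕ} (tl hd : Fin M → Fin n) where

    flowAcross : Vector Carrier M → Vector Carrier M → Subset n → Carrier
    flowAcross p q U = sum λ i → across (lookup U (tl i)) (lookup U (hd i)) (p i) (q i)

    netInflow : Vector Carrier M → Subset n → Carrier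
    netInflow f = flowAcross f (λ i → - f i)

    capacity : Vector Carrier M → Vector Carrier M → Subset n → Carrier
    capacity l u = flowAcross u (λ i → - l i)

    capacity-submodular : ∀ {l u} → (∀ i → l i ≤ u i) → Submodular (capacity l u)
    capacity-submodular {l} {u} l≤u U W = begin
      capacity l u (U ∪ W) + capacity l u (U ∩ W)  ≈⟨ ∑-distrib-+ (arc (U ∪ W)) (arc (U ∩ W)) ⟨
      sum (λ i → arc (U ∪ W) i + arc (U ∩ W) i)    ≤⟨ sum-mono-≤ arc-submodular ⟩
      sum (λ i → arc U i + arc W i)                ≈⟨ ∑-distrib-+ (arc U) (arc W) ⟩
      capacity l u U + capacity l u W              ∎
      where
      open ≤-Reasoning
      arc : Subset n → Vector Carrier M
      arc X i = across (lookup X (tl i)) (lookup X (hd i)) (u i) (- l i)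
      arc-submodular : ∀ i → arc (U ∪ W) i + arc (U ∩ W) i ≤ arc U i + arc W i
      arc-submodular i = ≡.subst₂ (λ p q → p + q ≤ arc U i + arc W i)
        (≡.sym (across-∪ U W (tl i) (hd i) (u i) (- l i))) (≡.sym (across-∩ U W (tl i) (hd i) (u i) (- l i)))
        (across-submodular (l≤u i) (lookup U (tl i)) (lookup U (hd i)) (lookup W (tl i)) (lookup W (hd i)))

    netInflow≈ : ∀ f X → netInflow f X ≈ sum (λ i → ([ lookup X (hd i) ] - [ lookup X (tl i) ]) * f i)
    netInflow≈ f X = sum-cong-≋ (λ i → across-net (lookup X (tl i)) (lookup X (hd i)) (f i))

    netInflow-decomposition : ∀ f X → netInflow f X ≈ sum (λ v → [ lookup X v ] * netInflow f ⁅ v ⁆)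
    netInflow-decomposition f X = sym (begin
      sum (λ v → [ lookup X v ] * netInflow f ⁅ v ⁆)
        ≈⟨ sum-cong-≋ (λ v → *-congˡ (netInflow≈ f ⁅ v ⁆)) ⟩
      sum (λ v → [ lookup X v ] * sum (λ i → ∂ v i * f i))
        ≈⟨ sum-cong-≋ (λ v → *-distribˡ-sum [ lookup X v ] (λ i → ∂ v i * f i)) ⟩
      sum (λ v → sum (λ i → [ lookup X v ] * (∂ v i * f i)))
        ≈⟨ ∑-comm (λ v i → [ lookup X v ] * (∂ v i * f i)) ⟩
      sum (λ i → sum (λ v → [ lookup X v ] * (∂ v i * f i)))
        ≈⟨ sum-cong-≋ (λ i → sum-linear (f i) (λ v → [ lookup X v ]) (λ v → ∂ v i)) ⟩
      sum (λ i → sum (λ v → [ lookup X v ] * ∂ v i) * f i)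
        ≈⟨ sum-cong-≋ (λ i → *-congʳ (expansion i)) ⟩
      sum (λ i → ([ lookup X (hd i) ] - [ lookup X (tl i) ]) * f i)
        ≈⟨ netInflow≈ f X ⟨
      netInflow f X
        ∎)
      where
      open ≈-Reasoning
      ∂ : Fin n → Fin M → Carrier
      ∂ v i = [ lookup ⁅ v ⁆ (hd i) ] - [ lookup ⁅ v ⁆ (tl i) ]
      sum-linear : ∀ x (a b : Vector Carrier n) → sum (λ v → a v * (b v * x)) ≈ sum (λ v → a v * b v) * x
      sum-linear x a b = trans (sum-cong-≋ (λ v → sym (*-assoc (a v) (b v) x))) (sym (*-distribʳ-sum x (λ v → a v * b v)))
      expansion : ∀ i → sum (λ v → [ lookup X v ] * ∂ v i) ≈ [ lookup X (hd i) ] - [ lookup X (tl i) ]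
      expansion i = begin
        sum (λ v → [ lookup X v ] * ∂ v i)
          ≈⟨ sum-cong-≋ (λ v → solve 3 (λ a b c → a :* (b :- c) := a :* b :- a :* c) refl
               [ lookup X v ] [ lookup ⁅ v ⁆ (hd i) ] [ lookup ⁅ v ⁆ (tl i) ]) ⟩
        sum (λ v → at (hd i) v - at (tl i) v)       ≈⟨ ∑-distrib-difference (at (hd i)) (at (tl i)) ⟩
        sum (at (hd i)) - sum (at (tl i))           ≈⟨ +-cong (membership-expansion X (hd i)) (-‿cong (membership-expansion X (tl i))) ⟩
        [ lookup X (hd i) ] - [ lookup X (tl i) ]   ∎
        where
        at : Fin n → Vector Carrier n
        at p v = [ lookup X v ] * [ lookup ⁅ v ⁆ p ]

  open Digraph using (netInflow; capacity; capacity-submodular)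

  feasible-flow : ∀ {n} M (tl hd : Fin M → Fin n) (l u : Vector Carrier M) → (∀ i → l i ≤ u i) →
    (β : Subset n → Carrier) → IsNetDemand β → (∀ U → β U ≤ capacity tl hd l u U) →
    ∃ λ f → (∀ i → l i ≤ f i × f i ≤ u i) × (∀ U → netInflow tl hd f U ≈ β U)
  feasible-flow zero tl hd l u _ β β-demand β≤0 =
    (λ ()) , (λ ()) , λ U → sym (nonpositive-netDemand≈0 β-demand β≤0 U)
  feasible-flow {n} (suc M) tl hd l u l≤u β β-demand β≤ = x Vector.∷ f , bounds , netInflow≈β
    where
    rest-capacity : Subset n → Carrier
    rest-capacity = capacity (tl ∘ suc) (hd ∘ suc) (l ∘ suc) (u ∘ suc)

    first-arc = fix-arc-value (tl zero) (hd zero) (l≤u zero) β rest-capacity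
                         (IsNetDemand.modular β-demand) (capacity-submodular (tl ∘ suc) (hd ∘ suc) (l≤u ∘ suc)) β≤

    x : Carrier
    x = proj₁ first-arc

    first-demand : Subset n → Carrier
    first-demand U = across (lookup U (tl zero)) (lookup U (hd zero)) x (- x)

    rest-flow = feasible-flow M (tl ∘ suc) (hd ∘ suc) (l ∘ suc) (u ∘ suc) (l≤u ∘ suc) (λ U → β U - first-demand U)
                              (difference-isNetDemand β-demand (arc-isNetDemand (tl zero) (hd zero) x)) (proj₂ (proj₂ first-arc))

    f : Vector Carrier M
    f = proj₁ rest-flow

    bounds : ∀ i → l i ≤ (x Vector.∷ f) i × (x Vector.∷ f) i ≤ u i
    bounds zero    = proj₁ (proj₂ first-arc)
    bounds (suc i) = proj₁ (proj₂ rest-flow) i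

    netInflow≈β : ∀ U → first-demand U + netInflow (tl ∘ suc) (hd ∘ suc) f U ≈ β U
    netInflow≈β U = trans (+-congˡ (proj₂ (proj₂ rest-flow) U)) (solve 2 (λ a b → a :+ (b :- a) := b) refl (first-demand U) (β U))

arcAt : ∀ {m} → Fin (m ℕ.* 2) → Arc m
arcAt {suc m} zero          = zero , plus
arcAt {suc m} (suc zero)    = zero , minus
arcAt {suc m} (suc (suc i)) = map₁ suc (arcAt i)

indexOf : ∀ {m} → Arc m → Fin (m ℕ.* 2)
indexOf (zero  , plus)  = zero
indexOf (zero  , minus) = suc zero
indexOf (suc e , d)     = suc (suc (indexOf (e , d)))

arcAt-indexOf : ∀ {m} (a : Arc m) → arcAt (indexOf a) ≡ a
arcAt-indexOf (zero  , plus)  = ≡.refl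
arcAt-indexOf (zero  , minus) = ≡.refl
arcAt-indexOf (suc e , d)     = ≡.cong (map₁ suc) (arcAt-indexOf (e , d))

indexOf-arcAt : ∀ {m} (i : Fin (m ℕ.* 2)) → indexOf {m} (arcAt i) ≡ i
indexOf-arcAt {suc m} zero          = ≡.refl
indexOf-arcAt {suc m} (suc zero)    = ≡.refl
indexOf-arcAt {suc m} (suc (suc i)) = ≡.cong (λ i′ → suc (suc i′)) (indexOf-arcAt {m} i)

module LiftedPolytope {c ℓ₁ ℓ₂} (F : OrderedField c ℓ₁ ℓ₂) where
  open OrderedField F hiding (zero; +-mono-≤) renaming (_≤_ to infix 4 _≤_)
  open OrderedFieldProperties F
  open CommutativeRingProperties commutativeRing
  open FeasibleFlows F
  open OnField F using (Σ; [_]; fromℕ; module Graph)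
  open IntegerCoefficientRingSolver commutativeRing using (solve; _:=_; _:+_; _:-_; _:*_; con)
  open import Algebra.Properties.Semiring.Sum semiring
    using (sum; sum-cong-≋; sum-cong-≗; ∑-distrib-+; *-distribˡ-sum; sum-replicate-zero)

  Σ≡sum : ∀ {m} (f : Vector Carrier m) → Σ f ≡ sum f
  Σ≡sum {zero}  f = ≡.refl
  Σ≡sum {suc m} f = ≡.cong (λ s → f zero + s) (Σ≡sum (f ∘ suc))

  sum-arcAt : ∀ {m} (h : Arc m → Carrier) → sum (h ∘ arcAt) ≈ sum (λ e → h (e , plus) + h (e , minus))
  sum-arcAt {zero}  h = refl
  sum-arcAt {suc m} h = trans (+-congˡ (+-congˡ (sum-arcAt (h ∘ map₁ suc)))) (sym (+-assoc _ _ _))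

  xor-split : ∀ a b {y⁺ y⁻} → y⁺ + y⁻ ≈ 1# →
    [ a Bool.xor b ] ≈ ([ a ∧ not b ] * y⁺ + [ b ∧ not a ] * y⁻) + ([ not a ∧ b ] * y⁺ + [ not b ∧ a ] * y⁻)
  xor-split false false {y⁺} {y⁻} _ =
    solve 2 (λ y⁺ y⁻ → con (+ 0) := (con (+ 0) :* y⁺ :+ con (+ 0) :* y⁻) :+ (con (+ 0) :* y⁺ :+ con (+ 0) :* y⁻)) refl y⁺ y⁻
  xor-split true  true  {y⁺} {y⁻} _ =
    solve 2 (λ y⁺ y⁻ → con (+ 0) := (con (+ 0) :* y⁺ :+ con (+ 0) :* y⁻) :+ (con (+ 0) :* y⁺ :+ con (+ 0) :* y⁻)) refl y⁺ y⁻
  xor-split true  false {y⁺} {y⁻} y⁺+y⁻≈1 = trans (sym y⁺+y⁻≈1)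
    (solve 2 (λ y⁺ y⁻ → y⁺ :+ y⁻ := (con (+ 1) :* y⁺ :+ con (+ 0) :* y⁻) :+ (con (+ 0) :* y⁺ :+ con (+ 1) :* y⁻)) refl y⁺ y⁻)
  xor-split false true  {y⁺} {y⁻} y⁺+y⁻≈1 = trans (sym y⁺+y⁻≈1)
    (solve 2 (λ y⁺ y⁻ → y⁺ :+ y⁻ := (con (+ 0) :* y⁺ :+ con (+ 1) :* y⁻) :+ (con (+ 1) :* y⁺ :+ con (+ 0) :* y⁻)) refl y⁺ y⁻)

  module _ {n m : ℕ} (ends : Fin m → Fin n × Fin n) where
    open Graph ends
    open Digraph (tail ∘ arcAt) (head ∘ arcAt) using (flowAcross; netInflow; capacity; netInflow-decomposition)

    arcSum≡sum : ∀ A y → arcSum A y ≡ sum (λ e → [ A (e , plus) ] * y (e , plus) + [ A (e , minus) ] * y (e , minus))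
    arcSum≡sum A y = Σ≡sum (λ e → [ A (e , plus) ] * y (e , plus) + [ A (e , minus) ] * y (e , minus))

    flowAcross-arcs : ∀ (p q : Arc m → Carrier) U →
      flowAcross (p ∘ arcAt) (λ i → - q (arcAt i)) U ≈ arcSum (enters U) p - arcSum (leaves U) q
    flowAcross-arcs p q U = begin
      sum (crossing ∘ arcAt)                                   ≈⟨ sum-arcAt crossing ⟩
      sum (λ e → crossing (e , plus) + crossing (e , minus))   ≈⟨ sum-cong-≋ regroup ⟩
      sum (λ e → entering e - leaving e)                       ≈⟨ ∑-distrib-difference entering leaving ⟩
      sum entering - sum leaving                               ≡⟨ ≡.cong₂ _-_ (arcSum≡sum (enters U) p) (arcSum≡sum (leaves U) q) ⟨
      arcSum (enters U) p - arcSum (leaves U) q                ∎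
      where
      open ≈-Reasoning
      crossing : Arc m → Carrier
      crossing a = across (tail a ∈ₛ U) (head a ∈ₛ U) (p a) (- q a)
      entering leaving : Fin m → Carrier
      entering e = [ enters U (e , plus) ] * p (e , plus) + [ enters U (e , minus) ] * p (e , minus)
      leaving  e = [ leaves U (e , plus) ] * q (e , plus) + [ leaves U (e , minus) ] * q (e , minus)
      split : ∀ a → crossing a ≈ [ enters U a ] * p a - [ leaves U a ] * q a
      split a = across-entering-leaving (tail a ∈ₛ U) (head a ∈ₛ U) (p a) (q a)
      regroup : ∀ e → crossing (e , plus) + crossing (e , minus) ≈ entering e - leaving e
      regroup e = trans (+-cong (split (e , plus)) (split (e , minus))) (difference-interchange _ _ _ _)

    cut-split : ∀ y → (∀ e → y (e , plus) + y (e , minus) ≈ 1#) → ∀ U → cut U ≈ arcSum (leaves U) y + arcSum (enters U) y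
    cut-split y pairSum U = begin
      cut U                                ≡⟨ Σ≡sum (λ e → [ crosses U e ]) ⟩
      sum (λ e → [ crosses U e ])          ≈⟨ sum-cong-≋ (λ e → xor-split (proj₁ (ends e) ∈ₛ U) (proj₂ (ends e) ∈ₛ U) (pairSum e)) ⟩
      sum (λ e → leaving e + entering e)   ≈⟨ ∑-distrib-+ leaving entering ⟩
      sum leaving + sum entering           ≡⟨ ≡.cong₂ _+_ (arcSum≡sum (leaves U) y) (arcSum≡sum (enters U) y) ⟨
      arcSum (leaves U) y + arcSum (enters U) y ∎
      where
      open ≈-Reasoning
      entering leaving : Fin m → Carrier
      entering e = [ enters U (e , plus) ] * y (e , plus) + [ enters U (e , minus) ] * y (e , minus)
      leaving  e = [ leaves U (e , plus) ] * y (e , plus) + [ leaves U (e , minus) ] * y (e , minus)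

    arcSum-scale : ∀ A k (y : Arc m → Carrier) → arcSum A (λ a → k * y a) ≈ k * arcSum A y
    arcSum-scale A k y = begin
      arcSum A (λ a → k * y a)   ≡⟨ arcSum≡sum A (λ a → k * y a) ⟩
      sum (λ e → [ A (e , plus) ] * (k * y (e , plus)) + [ A (e , minus) ] * (k * y (e , minus)))
        ≈⟨ sum-cong-≋ (λ e → solve 5 (λ a b k y y′ → a :* (k :* y) :+ b :* (k :* y′) := k :* (a :* y :+ b :* y′)) refl
                               [ A (e , plus) ] [ A (e , minus) ] k (y (e , plus)) (y (e , minus))) ⟩
      sum (λ e → k * term e)     ≈⟨ *-distribˡ-sum k term ⟨
      k * sum term               ≡⟨ ≡.cong (k *_) (arcSum≡sum A y) ⟨
      k * arcSum A y             ∎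
      where
      open ≈-Reasoning
      term : Fin m → Carrier
      term e = [ A (e , plus) ] * y (e , plus) + [ A (e , minus) ] * y (e , minus)

    arcSum-mono-≤ : ∀ A {y z : Arc m → Carrier} → (∀ a → y a ≤ z a) → arcSum A y ≤ arcSum A z
    arcSum-mono-≤ A {y} {z} y≤z = ≡.subst₂ _≤_ (≡.sym (arcSum≡sum A y)) (≡.sym (arcSum≡sum A z))
      (sum-mono-≤ (λ e → +-mono-≤ (*-monoʳ-≤-nonNeg (0≤[b] (A (e , plus))) (y≤z (e , plus)))
                                  (*-monoʳ-≤-nonNeg (0≤[b] (A (e , minus))) (y≤z (e , minus)))))

    conservation : ∀ (z : Arc m → Carrier) U → netInflow (z ∘ arcAt) U ≈ 0# ⇔ arcSum (leaves U) z ≈ arcSum (enters U) z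
    conservation z U = mk⇔ (Equivalence.to x-y≈0⇔y≈x ∘ trans (sym (flowAcross-arcs z z U)))
                           (trans (flowAcross-arcs z z U) ∘ Equivalence.from x-y≈0⇔y≈x)

    module _ (j : ℕ) (y : Arc m → Carrier) (pairSum : ∀ e → y (e , plus) + y (e , minus) ≈ 1#) where

      cutBound⇔ : ∀ U → fromℕ (suc (suc j)) * arcSum (leaves U) y ≤ fromℕ (suc j) * cut U
                        ⇔ arcSum (leaves U) y ≤ fromℕ (suc j) * arcSum (enters U) y
      cutBound⇔ U = mk⇔ (Equivalence.to bound⇔ ∘ ≤-respʳ-≈ (*-congˡ (cut-split y pairSum U)))
                        (≤-respʳ-≈ (*-congˡ (sym (cut-split y pairSum U))) ∘ Equivalence.from bound⇔)
        where bound⇔ = [1+k]x≤k[x+y]⇔x≤ky (fromℕ (suc j)) (arcSum (leaves U) y) (arcSum (enters U) y)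

      capacity-nonneg : (∀ U → fromℕ (suc (suc j)) * arcSum (leaves U) y ≤ fromℕ (suc j) * cut U) →
                        ∀ U → 0# ≤ capacity (y ∘ arcAt) (λ i → fromℕ (suc j) * y (arcAt i)) U
      capacity-nonneg cutBound U = ≤-respʳ-≈ (sym capacity≈) (x≤y⇒0≤y-x (Equivalence.to (cutBound⇔ U) (cutBound U)))
        where
        capacity≈ : capacity (y ∘ arcAt) (λ i → fromℕ (suc j) * y (arcAt i)) U
                    ≈ fromℕ (suc j) * arcSum (enters U) y - arcSum (leaves U) y
        capacity≈ = trans (flowAcross-arcs (λ a → fromℕ (suc j) * y a) y U) (+-congʳ (arcSum-scale (enters U) (fromℕ (suc j)) y))

    lift : ∀ j y → InQ (suc (suc j)) y → ∃ (InLift (suc (suc j)) y)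
    lift j y y∈Q = z , record { flow = flow ; pairSum = pairSum ; lower = lower ; upper = upper ; nonneg = nonneg }
      where
      open InQ y∈Q
      circulation = feasible-flow (m ℕ.* 2) (tail ∘ arcAt) (head ∘ arcAt) (y ∘ arcAt) (λ i → fromℕ (suc j) * y (arcAt i))
                                  (λ i → x≤[1+k]x (0≤fromℕ j) (nonneg (arcAt i))) (λ _ → 0#) 0-isNetDemand
                                  (capacity-nonneg j y pairSum cutBound)
      f : Vector Carrier (m ℕ.* 2)
      f = proj₁ circulation

      z : Arc m → Carrier
      z = f ∘ indexOf

      lower : ∀ a → y a ≤ z a
      lower a = ≡.subst (λ b → y b ≤ z a) (arcAt-indexOf a) (proj₁ (proj₁ (proj₂ circulation) (indexOf a)))

      upper : ∀ a → z a ≤ fromℕ (suc j) * y a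
      upper a = ≡.subst (λ b → z a ≤ fromℕ (suc j) * y b) (arcAt-indexOf a) (proj₂ (proj₁ (proj₂ circulation) (indexOf a)))

      reindex : ∀ X → netInflow (z ∘ arcAt) X ≡ netInflow f X
      reindex X = sum-cong-≗ (λ i → ≡.cong (λ i′ → across (lookup X (tail (arcAt i))) (lookup X (head (arcAt i))) (f i′) (- f i′))
                                           (indexOf-arcAt i))

      flow : ∀ v → arcSum (leaves ⁅ v ⁆) z ≈ arcSum (enters ⁅ v ⁆) z
      flow v = Equivalence.to (conservation z ⁅ v ⁆) (trans (reflexive (reindex ⁅ v ⁆)) (proj₂ (proj₂ circulation) ⁅ v ⁆))

    project : ∀ j y → ∃ (InLift (suc (suc j)) y) → InQ (suc (suc j)) y
    project j y (z , y≤z≤Ky) = record { cutBound = cutBound ; pairSum = pairSum ; nonneg = nonneg }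
      where
      open InLift y≤z≤Ky
      conserved : ∀ X → arcSum (leaves X) z ≈ arcSum (enters X) z
      conserved X = Equivalence.to (conservation z X) (begin
        netInflow (z ∘ arcAt) X                                      ≈⟨ netInflow-decomposition (z ∘ arcAt) X ⟩
        sum (λ v → [ lookup X v ] * netInflow (z ∘ arcAt) ⁅ v ⁆)     ≈⟨ sum-cong-≋ {n} (λ v → trans (*-congˡ (vertex v)) (zeroʳ _)) ⟩
        sum {n} (λ _ → 0#)                                           ≈⟨ sum-replicate-zero n ⟩
        0#                                                           ∎)
        where
        open ≈-Reasoning
        vertex : ∀ v → netInflow (z ∘ arcAt) ⁅ v ⁆ ≈ 0#
        vertex v = Equivalence.from (conservation z ⁅ v ⁆) (flow v)
      cutBound : ∀ U → fromℕ (suc (suc j)) * arcSum (leaves U) y ≤ fromℕ (suc j) * cut U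
      cutBound U = Equivalence.from (cutBound⇔ j y pairSum U) (begin
        arcSum (leaves U) y                            ≤⟨ arcSum-mono-≤ (leaves U) lower ⟩
        arcSum (leaves U) z                            ≈⟨ conserved U ⟩
        arcSum (enters U) z                            ≤⟨ arcSum-mono-≤ (enters U) upper ⟩
        arcSum (enters U) (λ a → fromℕ (suc j) * y a)  ≈⟨ arcSum-scale (enters U) (fromℕ (suc j)) y ⟩
        fromℕ (suc j) * arcSum (enters U) y            ∎)
        where open ≤-Reasoning

open import Data.Nat using (_≤_; s≤s)

lemma5p4 : ∀ {c ℓ₁ ℓ₂} (F : OrderedField c ℓ₁ ℓ₂) (k : ℕ) → 2 ≤ k →
    (n m : ℕ) (ends : Fin m → Fin n × Fin n) →
    (∀ e → proj₁ (ends e) ≢ proj₂ (ends e)) →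
    (y : Arc m → OrderedField.Carrier F) →
    OnField.Graph.InQ F ends k y ⇔ ∃ (λ z → OnField.Graph.InLift F ends k y z)
lemma5p4 F (suc (suc j)) (s≤s (s≤s _)) n m ends _ y = mk⇔ (lift ends j y) (project ends j y)
  where open LiftedPolytope F
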